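{- Let $a,b$ be positive integers. There exists a non-trivial tree $T$ with $i(T)=a$ and $i_{dR}(T)=b$ if and only if $2a+1\le b\le 3a$.
   Context: A non-trivial tree is a tree with at least two vertices. $i(T)$ is the independent domination number: the minimum cardinality of an independent dominating set. An independent double Roman dominating function (IDRDF) on a graph $G=(V,E)$ is a function $f:V\to\{0,1,2,3\}$ such that: every vertex $v$ with $f(v)=0$ has at least two neighbors $w$ with $f(w)=2$ or at least one neighbor $w$ with $f(w)=3$; every vertex $v$ with $f(v)=1$ has a neighbor $w$ with $f(w)\ge 2$; and $\{v: f(v)>0\}$ is independent. $i_{dR}(G)$ is the minimum weight $\sum_v f(v)$ of an IDRDF on $G$. -}

module Defs where

open import Data.Nat using (ℕ; zero; suc; _+_; _≤_)
open import Data.Fin using (Fin)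
open import Data.Bool using (Bool; true; false; T)
open import Data.List using (List; []; _∷_; length; last)
open import Data.List.Relation.Unary.Unique.Propositional using (Unique)
open import Data.Maybe using (just)
open import Data.Product using (Σ; _×_; ∃; _,_)
open import Data.Sum using (_⊎_)
open import Relation.Binary.PropositionalEquality using (_≡_; _≢_)
open import Relation.Nullary using (¬_)

record Graph (n : ℕ) : Set where
  field
    adj   : Fin n → Fin n → Bool
    sym   : ∀ u v → adj u v ≡ adj v u
    irrefl : ∀ v → adj v v ≡ false

module _ {n : ℕ} (G : Graph n) where
  open Graph G

  Adj : Fin n → Fin n → Set
  Adj u v = T (adj u v)

  AdjChain : List (Fin n) → Set
  AdjChain [] = Data.Unit.⊤ where import Data.Unit
  AdjChain (x ∷ []) = Data.Unit.⊤ where import Data.Unit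
  AdjChain (x ∷ y ∷ xs) = Adj x y × AdjChain (y ∷ xs)

  Walk : Fin n → Fin n → Set
  Walk u v = Σ (List (Fin n)) λ xs → Σ (List (Fin n)) λ ys →
             (u ∷ xs) ≡ ys × last ys ≡ just v × AdjChain ys

  Connected : Set
  Connected = ∀ u v → Walk u v

  HasCycle : Set
  HasCycle = Σ (Fin n) λ x → Σ (List (Fin n)) λ xs → Σ (Fin n) λ y →
             3 ≤ length (x ∷ xs) × last (x ∷ xs) ≡ just y ×
             Unique (x ∷ xs) × AdjChain (x ∷ xs) × Adj y x

  IsTree : Set
  IsTree = Connected × ¬ HasCycle

∑ : (n : ℕ) → (Fin n → ℕ) → ℕ
∑ zero f = 0
∑ (suc n) f = f Fin.zero + ∑ n (λ i → f (Fin.suc i))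
  where import Data.Fin as Fin

module _ {n : ℕ} (G : Graph n) where
  open Graph G

  VSet : Set
  VSet = Fin n → Bool

  card : VSet → ℕ
  card S = ∑ n (λ v → if S v then 1 else 0)
    where open import Data.Bool using (if_then_else_)

  Independent : VSet → Set
  Independent S = ∀ u v → T (S u) → T (S v) → ¬ Adj G u v

  Dominating : VSet → Set
  Dominating S = ∀ v → T (S v) ⊎ (Σ (Fin n) λ w → T (S w) × Adj G v w)

  IsIDS : VSet → Set
  IsIDS S = Independent S × Dominating S

  IndepDomNumber : ℕ → Set
  IndepDomNumber a = (Σ VSet λ S → IsIDS S × card S ≡ a) ×
                     (∀ S → IsIDS S → a ≤ card S)

  IsIDRDF : (Fin n → ℕ) → Set
  IsIDRDF f =
    (∀ v → f v ≤ 3) ×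
    (∀ v → f v ≡ 0 →
       (Σ (Fin n) λ w → Adj G v w × f w ≡ 3) ⊎
       (Σ (Fin n) λ w₁ → Σ (Fin n) λ w₂ → w₁ ≢ w₂ ×
          Adj G v w₁ × Adj G v w₂ × f w₁ ≡ 2 × f w₂ ≡ 2)) ×
    (∀ v → f v ≡ 1 → Σ (Fin n) λ w → Adj G v w × 2 ≤ f w) ×
    (∀ u v → Adj G u v → f u ≡ 0 ⊎ f v ≡ 0)

  weight : (Fin n → ℕ) → ℕ
  weight f = ∑ n f

  IndepDoubleRomanNumber : ℕ → Set
  IndepDoubleRomanNumber b = (Σ (Fin n → ℕ) λ f → IsIDRDF f × weight f ≡ b) ×
                             (∀ f → IsIDRDF f → b ≤ weight f)

module Submission where

-- For a, b ≥ 1 there is a non-trivial tree T with i(T) = a and i_dR(T) = b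
-- iff 2a + 1 ≤ b ≤ 3a.
--
-- Upper bound, in every graph (module Bounds): three times the indicator of an
-- independent dominating set is an IDRDF, so i_dR ≤ 3i.
-- Lower bound, in acyclic graphs with an edge (Exchange, idR≥2i+1): an IDRDF f
-- never takes the value 1, so its support S is independent dominating and
-- w(f) ≥ 2|S|, strictly so if f takes the value 3.  Otherwise some vertex v₀ on
-- an edge has f(v₀) = 0 and two neighbours of value 2, and {v₀} ∪ (S ∖ N(v₀))
-- is again independent dominating (a vertex losing both its 2-neighbours would
-- close a 4-cycle through v₀) of size ≤ |S| - 1.  Either way w(f) ≥ 2i + 1.
-- Realisation (Extremal): for a = 1 + t + s and b = 3 + 3t + 2s, the tree made
-- of a root with two leaves, t pendant claws and s pendant edges has i = a and
-- i_dR = b; the matching lower bounds come from local leaf estimates summed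
-- over these pieces.  The tree is built from a parent function that decreases
-- a rank, which always gives a tree (ParentTree).

open import Defs
open import Data.Nat using (ℕ; zero; suc; _+_; _*_; _≤_; _<_; z≤n; s≤s; _≟_; _≤?_)
open import Data.Nat.Properties
open import Data.Nat.Tactic.RingSolver using (solve-∀)
open import Data.Product using (Σ; _×_; _,_; proj₁; proj₂)
open import Data.Sum using (_⊎_; inj₁; inj₂)
open import Data.Fin using (Fin; _↑ˡ_; _↑ʳ_; splitAt; combine; remQuot; join)
  renaming (zero to fz; suc to fs)
import Data.Fin.Properties as Fin
open import Data.Bool using (Bool; true; false; T; if_then_else_; _∧_; _∨_; not)
open import Data.Bool.Properties using (∨-comm; ∧-zeroʳ; T-∨)
open import Data.Unit using (tt)
open import Data.List using (List; []; _∷_; length; last; _++_)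
open import Data.List.Properties using (++-assoc; ++-identityʳ; length-++)
open import Data.List.Relation.Unary.All as All using (All; []; _∷_)
open import Data.List.Relation.Unary.Any using (here; there)
open import Data.List.Relation.Unary.AllPairs using ([]; _∷_)
open import Data.List.Relation.Unary.Unique.Propositional using (Unique)
import Data.List.Relation.Unary.Unique.Propositional.Properties as Unique
open import Data.List.Membership.Propositional using (_∈_)
open import Data.List.Membership.Propositional.Properties using (∈-∃++; ∈-++⁺ˡ; ∈-++⁺ʳ; ∈-++⁻)
open import Data.Maybe using (just)
open import Data.Empty using (⊥; ⊥-elim)
open import Relation.Binary.PropositionalEquality
open import Relation.Nullary using (¬_; Dec; yes; no; does)
open import Relation.Nullary.Decidable using (dec-true; dec-false; T?)
open import Algebra.Properties.CommutativeSemigroup +-commutativeSemigroup using (interchange)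
open import Function.Bundles using (_⇔_; mk⇔; Equivalence)

∑-cong : ∀ n {g h : Fin n → ℕ} → (∀ i → g i ≡ h i) → ∑ n g ≡ ∑ n h
∑-cong zero    eq = refl
∑-cong (suc n) eq = cong₂ _+_ (eq fz) (∑-cong n (λ i → eq (fs i)))

∑-mono : ∀ n {g h : Fin n → ℕ} → (∀ i → g i ≤ h i) → ∑ n g ≤ ∑ n h
∑-mono zero    le = z≤n
∑-mono (suc n) le = +-mono-≤ (le fz) (∑-mono n (λ i → le (fs i)))

∑-+ : ∀ n (g h : Fin n → ℕ) → ∑ n (λ i → g i + h i) ≡ ∑ n g + ∑ n h
∑-+ zero    g h = refl
∑-+ (suc n) g h = trans (cong (g fz + h fz +_) (∑-+ n (λ i → g (fs i)) (λ i → h (fs i))))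
                        (interchange (g fz) (h fz) _ _)

∑-* : ∀ n c (g : Fin n → ℕ) → ∑ n (λ i → c * g i) ≡ c * ∑ n g
∑-* zero    c g = sym (*-zeroʳ c)
∑-* (suc n) c g = trans (cong (c * g fz +_) (∑-* n c (λ i → g (fs i))))
                        (sym (*-distribˡ-+ c (g fz) _))

∑-const : ∀ n c → ∑ n (λ _ → c) ≡ n * c
∑-const zero    c = refl
∑-const (suc n) c = cong (c +_) (∑-const n c)

∑-mono-< : ∀ n {g h : Fin n → ℕ} (c : Fin n) → (∀ i → g i ≤ h i) → g c < h c → ∑ n g < ∑ n h
∑-mono-< (suc n) fz     le lt = +-mono-<-≤ lt (∑-mono n (λ i → le (fs i)))
∑-mono-< (suc n) (fs c) le lt = +-mono-≤-< (le fz) (∑-mono-< n c (λ i → le (fs i)) lt)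

∑-≥ : ∀ n c (g : Fin n → ℕ) → (∀ i → c ≤ g i) → n * c ≤ ∑ n g
∑-≥ n c g le = subst (_≤ ∑ n g) (∑-const n c) (∑-mono n le)

ind : Bool → ℕ
ind b = if b then 1 else 0

ind≤1 : ∀ b → ind b ≤ 1
ind≤1 true  = ≤-refl
ind≤1 false = z≤n

T⇒≡true : ∀ {b} → T b → b ≡ true
T⇒≡true {true} _ = refl

δ : ∀ {n} → Fin n → Fin n → ℕ
δ c u = ind (does (u Fin.≟ c))

∑-δ : ∀ n (c : Fin n) → ∑ n (δ c) ≡ 1
∑-δ (suc n) fz     = cong suc (trans (∑-const n 0) (*-zeroʳ n))
∑-δ (suc n) (fs c) = ∑-δ n c

δ-self : ∀ {n} (c : Fin n) → δ c c ≡ 1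
δ-self c = cong ind (dec-true (c Fin.≟ c) refl)

δ-other : ∀ {n} {c u : Fin n} → u ≢ c → δ c u ≡ 0
δ-other {c = c} {u} u≢c = cong ind (dec-false (u Fin.≟ c) u≢c)

∑-split : ∀ m k (g : Fin (m + k) → ℕ) →
          ∑ (m + k) g ≡ ∑ m (λ i → g (i ↑ˡ k)) + ∑ k (λ i → g (m ↑ʳ i))
∑-split zero    k g = refl
∑-split (suc m) k g = trans (cong (g fz +_) (∑-split m k (λ i → g (fs i))))
                            (sym (+-assoc (g fz) _ _))

∑-combine : ∀ m k (g : Fin (m * k) → ℕ) →
            ∑ (m * k) g ≡ ∑ m (λ i → ∑ k (λ j → g (combine i j)))
∑-combine zero    k g = refl
∑-combine (suc m) k g = trans (∑-split k (m * k) g)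
  (cong (∑ k (λ j → g (j ↑ˡ (m * k))) +_) (∑-combine m k (λ i → g (k ↑ʳ i))))

module GraphFacts {n : ℕ} (G : Graph n) where
  open Graph G renaming (sym to adj-symmetric)

  adj-sym : ∀ {u v} → Adj G u v → Adj G v u
  adj-sym {u} {v} = subst T (adj-symmetric u v)

  adj-irrefl : ∀ v → ¬ Adj G v v
  adj-irrefl v a = subst T (irrefl v) a

  adj⇒≢ : ∀ {u v} → Adj G u v → u ≢ v
  adj⇒≢ a refl = adj-irrefl _ a

  square : ∀ {a b c d} → Adj G a b → Adj G b c → Adj G c d → Adj G d a →
           a ≢ c → b ≢ d → HasCycle G
  square {a} {b} {c} {d} ab bc cd da a≢c b≢d =
    a , b ∷ c ∷ d ∷ [] , d , s≤s (s≤s (s≤s z≤n)) , refl ,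
    (adj⇒≢ ab ∷ a≢c ∷ (λ a≡d → adj⇒≢ da (sym a≡d)) ∷ []) ∷
      (adj⇒≢ bc ∷ b≢d ∷ []) ∷ (adj⇒≢ cd ∷ []) ∷ [] ∷ [] ,
    (ab , bc , cd , tt) , da

module Bounds {n : ℕ} (G : Graph n) where
  open GraphFacts G

  ZeroGuarded : (Fin n → ℕ) → Fin n → Set
  ZeroGuarded f v = (Σ (Fin n) λ w → Adj G v w × f w ≡ 3) ⊎
                    (Σ (Fin n) λ w₁ → Σ (Fin n) λ w₂ → w₁ ≢ w₂ ×
                       Adj G v w₁ × Adj G v w₂ × f w₁ ≡ 2 × f w₂ ≡ 2)

  OneGuarded : (Fin n → ℕ) → Fin n → Set
  OneGuarded f v = Σ (Fin n) λ w → Adj G v w × 2 ≤ f w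

  tripled : VSet G → Fin n → ℕ
  tripled S v = if S v then 3 else 0

  tripled-IDRDF : ∀ S → IsIDS G S → IsIDRDF G (tripled S)
  tripled-IDRDF S (indep , dom) = bounded , zero-rule , one-rule , independent
    where
    bounded : ∀ v → tripled S v ≤ 3
    bounded v with S v
    ... | true  = ≤-refl
    ... | false = z≤n
    zero-rule : ∀ v → tripled S v ≡ 0 → ZeroGuarded (tripled S) v
    zero-rule v eq with S v in Sv | dom v
    zero-rule v () | true  | _
    ... | false | inj₁ v∈S = ⊥-elim v∈S
    ... | false | inj₂ (w , w∈S , vw) = inj₁ (w , vw , cong (λ b → if b then 3 else 0) (T⇒≡true w∈S))
    one-rule : ∀ v → tripled S v ≡ 1 → OneGuarded (tripled S) v
    one-rule v eq with S v
    one-rule v () | true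
    one-rule v () | false
    independent : ∀ u v → Adj G u v → tripled S u ≡ 0 ⊎ tripled S v ≡ 0
    independent u v uv with S u in Su | S v in Sv
    ... | false | _     = inj₁ refl
    ... | true  | false = inj₂ refl
    ... | true  | true  = ⊥-elim (indep u v (subst T (sym Su) tt) (subst T (sym Sv) tt) uv)

  tripled-weight : ∀ S → weight G (tripled S) ≡ 3 * card G S
  tripled-weight S = trans (∑-cong n pointwise) (∑-* n 3 (λ v → ind (S v)))
    where
    pointwise : ∀ v → tripled S v ≡ 3 * ind (S v)
    pointwise v with S v
    ... | true  = refl
    ... | false = refl

  idR≤3i : ∀ {a b} → IndepDomNumber G a → IndepDoubleRomanNumber G b → b ≤ 3 * a
  idR≤3i ((S , ids , |S|≡a) , _) (_ , minimal) =
    ≤-trans (minimal (tripled S) (tripled-IDRDF S ids))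
            (≤-reflexive (trans (tripled-weight S) (cong (3 *_) |S|≡a)))

  -- An IDRDF never uses the value 1: a vertex of value 1 would have a
  -- neighbour of value ≥ 2, violating independence of the support.
  IDRDF-no-1 : ∀ {f} → IsIDRDF G f → ∀ v → f v ≢ 1
  IDRDF-no-1 {f} (_ , _ , one-rule , indep) v fv≡1 with one-rule v fv≡1
  ... | w , vw , 2≤fw with indep v w vw
  ... | inj₁ fv≡0 = 1+n≢0 (trans (sym fv≡1) fv≡0)
  ... | inj₂ fw≡0 = <⇒≱ (s≤s z≤n) (subst (2 ≤_) fw≡0 2≤fw)

  IDRDF-positive : ∀ {f} → IsIDRDF G f → ∀ v → f v ≢ 0 → 2 ≤ f v
  IDRDF-positive {f} idr v fv≢0 with f v | IDRDF-no-1 idr v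
  ... | zero          | _   = ⊥-elim (fv≢0 refl)
  ... | suc zero      | no1 = ⊥-elim (no1 refl)
  ... | suc (suc _)   | _   = s≤s (s≤s z≤n)

  positive : ℕ → Bool
  positive zero    = false
  positive (suc _) = true

  support : (Fin n → ℕ) → VSet G
  support f v = positive (f v)

  support-≢0 : ∀ {f v} → f v ≢ 0 → T (support f v)
  support-≢0 {f} {v} fv≢0 with f v
  ... | zero  = fv≢0 refl
  ... | suc _ = tt

  support-IDS : ∀ {f} → IsIDRDF G f → IsIDS G (support f)
  support-IDS {f} (_ , zero-rule , _ , indep) = independent , dominating
    where
    positive-≡0 : ∀ {x} → x ≡ 0 → ¬ T (positive x)
    positive-≡0 refl ()
    positive-suc : ∀ {x k} → x ≡ suc k → T (positive x)
    positive-suc refl = tt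
    independent : Independent G (support f)
    independent u v u∈S v∈S uv with indep u v uv
    ... | inj₁ fu≡0 = positive-≡0 fu≡0 u∈S
    ... | inj₂ fv≡0 = positive-≡0 fv≡0 v∈S
    dominating : Dominating G (support f)
    dominating v with f v in fv
    ... | suc _ = inj₁ tt
    ... | zero with zero-rule v fv
    ... | inj₁ (w , vw , fw≡3) = inj₂ (w , positive-suc fw≡3 , vw)
    ... | inj₂ (w , _ , _ , vw , _ , fw≡2 , _) = inj₂ (w , positive-suc fw≡2 , vw)

  support-pointwise : ∀ {f} → IsIDRDF G f → ∀ v → 2 * ind (support f v) ≤ f v
  support-pointwise {f} idr v with f v in fv
  ... | zero  = z≤n
  ... | suc k = subst (2 ≤_) fv (IDRDF-positive idr v (λ fv≡0 → 0≢1+n (trans (sym fv≡0) fv)))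

  support-weight : ∀ {f} → IsIDRDF G f → 2 * card G (support f) ≤ weight G f
  support-weight {f} idr =
    subst (_≤ weight G f) (∑-* n 2 (λ v → ind (support f v))) (∑-mono n (support-pointwise idr))

  LeafAt : Fin n → Fin n → Set
  LeafAt l x = ∀ w → Adj G l w → w ≡ x

  leaf-IDS : ∀ {S l x} → LeafAt l x → IsIDS G S → 1 ≤ ind (S x) + ind (S l)
  leaf-IDS {S} {l} {x} leaf (_ , dom) with dom l
  ... | inj₁ l∈S = subst (λ b → 1 ≤ ind (S x) + ind b) (sym (T⇒≡true l∈S)) (m≤n+m 1 _)
  ... | inj₂ (w , w∈S , lw) with leaf w lw
  ... | refl = subst (λ b → 1 ≤ ind b + ind (S l)) (sym (T⇒≡true w∈S)) (s≤s z≤n)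

  -- An IDRDF vanishing on l gives x the value 3 (l has no two neighbours).
  leaf-zero : ∀ {f l x} → LeafAt l x → IsIDRDF G f → f l ≡ 0 → f x ≡ 3
  leaf-zero leaf (_ , zero-rule , _) fl≡0 with zero-rule _ fl≡0
  ... | inj₁ (w , lw , fw≡3) with leaf w lw
  ... | refl = fw≡3
  leaf-zero leaf (_ , zero-rule , _) fl≡0 | inj₂ (w₁ , w₂ , w₁≢w₂ , lw₁ , lw₂ , _)
    with leaf w₁ lw₁ | leaf w₂ lw₂
  ... | refl | refl = ⊥-elim (w₁≢w₂ refl)

  leaf-IDRDF : ∀ {f l x} → LeafAt l x → IsIDRDF G f → 2 ≤ f x + f l
  leaf-IDRDF {f} {l} {x} leaf idr with f l ≟ 0
  ... | yes fl≡0 = subst (λ k → 2 ≤ k + f l) (sym (leaf-zero leaf idr fl≡0)) (s≤s (s≤s z≤n))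
  ... | no  fl≢0 = ≤-trans (IDRDF-positive idr l fl≢0) (m≤n+m (f l) (f x))

  cherry-IDRDF : ∀ {f p q x} → LeafAt p x → LeafAt q x → Adj G p x →
                 IsIDRDF G f → 3 ≤ f x + (f p + f q)
  cherry-IDRDF {f} {p} {q} {x} leaf-p leaf-q px idr@(_ , _ , _ , indep) with f x ≟ 0
  ... | yes fx≡0 = subst (λ k → 3 ≤ k + (f p + f q)) (sym fx≡0)
                     (+-mono-≤ (keeps leaf-p) (≤-trans (s≤s z≤n) (keeps leaf-q)))
    where
    keeps : ∀ {l} → LeafAt l x → 2 ≤ f l
    keeps leaf = IDRDF-positive idr _ (λ fl≡0 → 1+n≢0 (trans (sym (leaf-zero leaf idr fl≡0)) fx≡0))
  ... | no fx≢0 with indep p x px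
  ... | inj₂ fx≡0 = ⊥-elim (fx≢0 fx≡0)
  ... | inj₁ fp≡0 = subst (λ k → 3 ≤ k + (f p + f q)) (sym (leaf-zero leaf-p idr fp≡0))
                          (m≤m+n 3 _)

module Exchange {n : ℕ} (G : Graph n) (acyclic : ¬ HasCycle G)
                {f : Fin n → ℕ} (idr : IsIDRDF G f) (no-3 : ∀ v → f v ≢ 3)
                (v₀ : Fin n) (fv₀≡0 : f v₀ ≡ 0) where
  open Graph G using (adj)
  open GraphFacts G
  open Bounds G

  two-neighbours : ∀ u → f u ≡ 0 → Σ (Fin n) λ w₁ → Σ (Fin n) λ w₂ → w₁ ≢ w₂ ×
                   Adj G u w₁ × Adj G u w₂ × f w₁ ≡ 2 × f w₂ ≡ 2
  two-neighbours u fu≡0 with proj₁ (proj₂ idr) u fu≡0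
  ... | inj₁ (w , _ , fw≡3) = ⊥-elim (no-3 w fw≡3)
  ... | inj₂ neighbours = neighbours

  S : VSet G
  S = support f

  S' : VSet G
  S' u = does (u Fin.≟ v₀) ∨ (S u ∧ not (adj v₀ u))

  S'-away : ∀ {u} → u ≢ v₀ → S' u ≡ S u ∧ not (adj v₀ u)
  S'-away {u} u≢v₀ = cong (_∨ (S u ∧ not (adj v₀ u))) (dec-false (u Fin.≟ v₀) u≢v₀)

  two∈S : ∀ {w} → f w ≡ 2 → S w ≡ true
  two∈S fw≡2 = cong positive fw≡2

  v₀∈S' : T (S' v₀)
  v₀∈S' = subst (λ b → T (b ∨ (S v₀ ∧ not (adj v₀ v₀)))) (sym (dec-true (v₀ Fin.≟ v₀) refl)) tt

  in-S' : ∀ {w} → T (S w) → ¬ Adj G v₀ w → T (S' w)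
  in-S' {w} w∈S v₀≁w with does (w Fin.≟ v₀) | S w | adj v₀ w
  ... | true  | _     | _     = tt
  ... | false | false | _     = w∈S
  ... | false | true  | false = tt
  ... | false | true  | true  = v₀≁w tt

  from-S' : ∀ {u} → u ≢ v₀ → T (S' u) → T (S u) × ¬ Adj G v₀ u
  from-S' {u} u≢v₀ u∈S' = split (subst T (S'-away u≢v₀) u∈S')
    where
    split : ∀ {b c} → T (b ∧ not c) → T b × ¬ T c
    split {true} {false} _ = tt , λ ()

  S'-independent : Independent G S'
  S'-independent u u' u∈S' u'∈S' uu' with v₀ Fin.≟ u | v₀ Fin.≟ u'
  ... | yes refl | yes refl = adj-irrefl _ uu'
  ... | yes refl | no v₀≢u' = proj₂ (from-S' (≢-sym v₀≢u') u'∈S') uu'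
  ... | no v₀≢u  | yes refl = proj₂ (from-S' (≢-sym v₀≢u) u∈S') (adj-sym uu')
  ... | no v₀≢u  | no v₀≢u' =
    proj₁ (support-IDS idr) u u' (proj₁ (from-S' (≢-sym v₀≢u) u∈S'))
                                 (proj₁ (from-S' (≢-sym v₀≢u') u'∈S')) uu'

  -- A vertex of value 0 outside the closed neighbourhood of v₀ keeps one of its
  -- two 2-neighbours in S': if both were adjacent to v₀, u x₁ v₀ x₂ would be a
  -- 4-cycle.
  zero-dominated : ∀ u → f u ≡ 0 → u ≢ v₀ → ¬ Adj G v₀ u →
                   Σ (Fin n) λ w → T (S' w) × Adj G u w
  zero-dominated u fu≡0 u≢v₀ v₀≁u with two-neighbours u fu≡0
  ... | x₁ , x₂ , x₁≢x₂ , ux₁ , ux₂ , fx₁ , fx₂ with T? (adj v₀ x₁) | T? (adj v₀ x₂)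
  ... | no v₀≁x₁ | _         = x₁ , in-S' (subst T (sym (two∈S fx₁)) tt) v₀≁x₁ , ux₁
  ... | yes _    | no v₀≁x₂  = x₂ , in-S' (subst T (sym (two∈S fx₂)) tt) v₀≁x₂ , ux₂
  ... | yes v₀x₁ | yes v₀x₂  =
    ⊥-elim (acyclic (square ux₁ (adj-sym v₀x₁) v₀x₂ (adj-sym ux₂) u≢v₀ x₁≢x₂))

  S'-dominating : Dominating G S'
  S'-dominating u with v₀ Fin.≟ u
  ... | yes refl = inj₁ v₀∈S'
  ... | no v₀≢u with T? (adj v₀ u)
  ... | yes v₀u = inj₂ (v₀ , v₀∈S' , adj-sym v₀u)
  ... | no v₀≁u with f u ≟ 0
  ... | yes fu≡0 = inj₂ (zero-dominated u fu≡0 (≢-sym v₀≢u) v₀≁u)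
  ... | no fu≢0  = inj₁ (in-S' (support-≢0 {f} {u} fu≢0) v₀≁u)

  S'-IDS : IsIDS G S'
  S'-IDS = S'-independent , S'-dominating

  -- Counting with point indicators: S' gains v₀ but loses both 2-neighbours of v₀.
  S'-smaller : card G S' + 1 ≤ card G S
  S'-smaller with two-neighbours v₀ fv₀≡0
  ... | x₁ , x₂ , x₁≢x₂ , v₀x₁ , v₀x₂ , fx₁ , fx₂ =
    +-cancelʳ-≤ 1 _ _ (subst₂ _≤_ lhs rhs (∑-mono n pointwise))
    where
    S'-drops : ∀ {w} → Adj G v₀ w → S' w ≡ false
    S'-drops {w} v₀w rewrite S'-away (≢-sym (adj⇒≢ v₀w)) | T⇒≡true v₀w = ∧-zeroʳ (S w)
    ind-∧ : ∀ b c → ind (b ∧ c) ≤ ind b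
    ind-∧ true  true  = ≤-refl
    ind-∧ true  false = z≤n
    ind-∧ false c     = z≤n
    x₁≢v₀ : x₁ ≢ v₀
    x₁≢v₀ = ≢-sym (adj⇒≢ v₀x₁)
    x₂≢v₀ : x₂ ≢ v₀
    x₂≢v₀ = ≢-sym (adj⇒≢ v₀x₂)
    pointwise : ∀ u → ind (S' u) + δ x₁ u + δ x₂ u ≤ ind (S u) + δ v₀ u
    pointwise u with x₁ Fin.≟ u | x₂ Fin.≟ u | v₀ Fin.≟ u
    ... | yes refl | _ | _ rewrite S'-drops v₀x₁ | δ-self x₁ | δ-other x₁≢x₂
                               | two∈S fx₁ | δ-other x₁≢v₀ = ≤-refl
    ... | no x₁≢u | yes refl | _ rewrite S'-drops v₀x₂ | δ-self x₂ | δ-other (≢-sym x₁≢u)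
                               | two∈S fx₂ | δ-other x₂≢v₀ = ≤-refl
    ... | no x₁≢u | no x₂≢u | yes refl rewrite δ-other (≢-sym x₁≢u) | δ-other (≢-sym x₂≢u)
                               | δ-self v₀ | +-identityʳ (ind (S' v₀)) | +-identityʳ (ind (S' v₀)) =
      ≤-trans (ind≤1 (S' v₀)) (m≤n+m 1 _)
    ... | no x₁≢u | no x₂≢u | no v₀≢u rewrite δ-other (≢-sym x₁≢u) | δ-other (≢-sym x₂≢u)
                               | δ-other (≢-sym v₀≢u) | S'-away (≢-sym v₀≢u) =
      +-mono-≤ (≤-trans (≤-reflexive (+-identityʳ _)) (ind-∧ (S u) _)) z≤n
    lhs : ∑ n (λ u → ind (S' u) + δ x₁ u + δ x₂ u) ≡ card G S' + 1 + 1
    lhs = trans (∑-+ n _ _) (cong₂ _+_ (trans (∑-+ n _ _) (cong (card G S' +_) (∑-δ n x₁))) (∑-δ n x₂))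
    rhs : ∑ n (λ u → ind (S u) + δ v₀ u) ≡ card G S + 1
    rhs = trans (∑-+ n _ _) (cong (card G S +_) (∑-δ n v₀))

connected-edge : ∀ {n} (G : Graph n) → 2 ≤ n → Connected G →
                 Σ (Fin n) λ u → Σ (Fin n) λ w → Adj G u w
connected-edge {suc (suc _)} G (s≤s (s≤s z≤n)) connected with connected fz (fs fz)
... | [] , _ , refl , () , _
... | w ∷ _ , _ , refl , _ , (uw , _) = fz , w , uw

idR≥2i+1 : ∀ {n} (G : Graph n) → ¬ HasCycle G → (Σ (Fin n) λ u → Σ (Fin n) λ w → Adj G u w) →
           ∀ {a} → (∀ S → IsIDS G S → a ≤ card G S) →
           ∀ f → IsIDRDF G f → 2 * a + 1 ≤ weight G f
idR≥2i+1 {n} G acyclic (u , w , uw) {a} a-min f idr with Fin.any? (λ v → f v ≟ 3)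
-- With a 3 at v: the support bound 2·χ_S ≤ f is strict at v.
... | yes (v , fv≡3) = begin
  2 * a + 1                               ≤⟨ +-monoˡ-≤ 1 (*-monoʳ-≤ 2 (a-min _ (support-IDS idr))) ⟩
  2 * card G (support f) + 1              ≡⟨ +-comm _ 1 ⟩
  suc (2 * card G (support f))            ≡⟨ cong suc (∑-* n 2 _) ⟨
  suc (∑ n (λ x → 2 * ind (support f x))) ≤⟨ ∑-mono-< n v (support-pointwise idr) at-v ⟩
  weight G f                              ∎
  where
  open Bounds G
  open ≤-Reasoning
  at-v : 2 * ind (support f v) < f v
  at-v rewrite fv≡3 = ≤-refl
-- Without 3s: exchange at a vertex of value 0 on the given edge.
... | no no-3 = begin
  2 * a + 1              ≤⟨ +-monoʳ-≤ (2 * a) (s≤s (z≤n {1})) ⟩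
  2 * a + 2              ≡⟨ *-distribˡ-+ 2 a 1 ⟨
  2 * (a + 1)            ≤⟨ *-monoʳ-≤ 2 (≤-trans (+-monoˡ-≤ 1 (a-min S' S'-IDS)) S'-smaller) ⟩
  2 * card G (support f) ≤⟨ support-weight idr ⟩
  weight G f             ∎
  where
  open Bounds G
  open ≤-Reasoning
  zero-endpoint : Σ (Fin n) λ v₀ → f v₀ ≡ 0
  zero-endpoint with proj₂ (proj₂ (proj₂ idr)) u w uw
  ... | inj₁ fu≡0 = u , fu≡0
  ... | inj₂ fw≡0 = w , fw≡0
  open Exchange G acyclic idr (λ v fv≡3 → no-3 (v , fv≡3)) (proj₁ zero-endpoint) (proj₂ zero-endpoint)

module _ {A : Set} where
  lastOr : A → List A → A
  lastOr x []       = x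
  lastOr x (y ∷ ys) = lastOr y ys

  last⇒lastOr : ∀ x xs {y} → last (x ∷ xs) ≡ just y → lastOr x xs ≡ y
  last⇒lastOr x []       refl = refl
  last⇒lastOr x (z ∷ zs) eq   = last⇒lastOr z zs eq

  lastOr-∈ : ∀ x y ys → lastOr x (y ∷ ys) ∈ y ∷ ys
  lastOr-∈ x y []       = here refl
  lastOr-∈ x y (z ∷ zs) = there (lastOr-∈ y z zs)

  lastOr-snoc : ∀ x xs z → lastOr x (xs ++ z ∷ []) ≡ z
  lastOr-snoc x []       z = refl
  lastOr-snoc x (y ∷ ys) z = lastOr-snoc y ys z

module Paths {n : ℕ} (G : Graph n) where
  open GraphFacts G

  data Path : Fin n → Fin n → Set where
    stop : ∀ {v} → Path v v
    step : ∀ {u w v} → Adj G u w → Path w v → Path u v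

  _▸_ : ∀ {u w v} → Path u w → Path w v → Path u v
  stop       ▸ q = q
  step uw p  ▸ q = step uw (p ▸ q)

  reverse : ∀ {u v} → Path u v → Path v u
  reverse stop        = stop
  reverse (step uw p) = reverse p ▸ step (adj-sym uw) stop

  interior : ∀ {u v} → Path u v → List (Fin n)
  interior stop                 = []
  interior (step {w = w} _ p)   = w ∷ interior p

  path⇒walk : ∀ {u v} → Path u v → Walk G u v
  path⇒walk {u} {v} p = interior p , u ∷ interior p , refl , ends p , chain p
    where
    ends : ∀ {u v} (p : Path u v) → last (u ∷ interior p) ≡ just v
    ends stop         = refl
    ends (step _ p)   = ends p
    chain : ∀ {u v} (p : Path u v) → AdjChain G (u ∷ interior p)
    chain stop        = tt
    chain (step uw p) = uw , chain p

module Cycles {n : ℕ} (G : Graph n) where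
  Cycle : List (Fin n) → Set
  Cycle []       = ⊥
  Cycle (x ∷ xs) = 3 ≤ length (x ∷ xs) × Unique (x ∷ xs) × AdjChain G (x ∷ xs) ×
                   Adj G (lastOr x xs) x

  hasCycle⇒Cycle : HasCycle G → Σ (List (Fin n)) Cycle
  hasCycle⇒Cycle (x , xs , y , long , last≡y , unique , chain , yx) =
    x ∷ xs , long , unique , chain , subst (λ w → Adj G w x) (sym (last⇒lastOr x xs last≡y)) yx

  chain-snoc : ∀ x xs z → AdjChain G (x ∷ xs) → Adj G (lastOr x xs) z →
               AdjChain G (x ∷ xs ++ z ∷ [])
  chain-snoc x []       z _             xz = xz , tt
  chain-snoc x (y ∷ ys) z (xy , chain) yz = xy , chain-snoc y ys z chain yz

  rotate₁ : ∀ x y ys → Cycle (x ∷ y ∷ ys) → Cycle (y ∷ ys ++ x ∷ [])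
  rotate₁ x y ys (long , (x∉ ∷ unique) , (xy , chain) , closing) =
    subst (3 ≤_) (cong suc (sym (trans (length-++ ys) (+-comm _ 1)))) long ,
    Unique.++⁺ unique ([] ∷ []) (λ { (v∈ , here refl) → All.lookup x∉ v∈ refl }) ,
    chain-snoc y ys x chain closing ,
    subst (λ w → Adj G w y) (sym (lastOr-snoc y ys x)) xy

  rotate : ∀ p m q → Cycle (p ++ m ∷ q) → Cycle (m ∷ q ++ p)
  rotate []           m q c = subst Cycle (cong (m ∷_) (sym (++-identityʳ q))) c
  rotate (x ∷ [])     m q c = rotate₁ x m q c
  rotate (x ∷ y ∷ ys) m q c =
    subst Cycle (cong (m ∷_) (++-assoc q (x ∷ []) (y ∷ ys)))
      (rotate (y ∷ ys) m (q ++ x ∷ [])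
        (subst Cycle (cong (y ∷_) (++-assoc ys (m ∷ q) (x ∷ []))) (rotate₁ x y (ys ++ m ∷ q) c)))

-- A graph whose edges all join a vertex to its parent, the parent having
-- smaller rank, has no cycle: at a rank-maximal vertex m of a cycle both cycle
-- neighbours would be the parent of m, contradicting that they are distinct.
module RankedAcyclic {n : ℕ} (G : Graph n) (parent : Fin n → Fin n) (rank : Fin n → ℕ)
  (oriented : ∀ u v → Adj G u v →
              (parent u ≡ v × rank v < rank u) ⊎ (parent v ≡ u × rank u < rank v)) where
  open GraphFacts G
  open Cycles G

  rank-max : ∀ x xs → Σ (Fin n) λ m → m ∈ x ∷ xs × (∀ z → z ∈ x ∷ xs → rank z ≤ rank m)
  rank-max x [] = x , here refl , λ { z (here refl) → ≤-refl }
  rank-max x (y ∷ ys) with rank-max y ys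
  ... | m , m∈ , bound with rank x ≤? rank m
  ... | yes x≤m = m , there m∈ , λ { z (here refl) → x≤m ; z (there z∈) → bound z z∈ }
  ... | no  x≰m = x , here refl ,
    λ { z (here refl) → ≤-refl ; z (there z∈) → ≤-trans (bound z z∈) (<⇒≤ (≰⇒> x≰m)) }

  up-to-parent : ∀ m w → rank w ≤ rank m → Adj G m w → parent m ≡ w
  up-to-parent m w w≤m mw with oriented m w mw
  ... | inj₁ (parent≡w , _) = parent≡w
  ... | inj₂ (_ , m<w)      = ⊥-elim (<⇒≱ m<w w≤m)

  no-maximal-start : ∀ m r → Cycle (m ∷ r) → (∀ z → z ∈ r → rank z ≤ rank m) → ⊥
  no-maximal-start m [] (s≤s () , _) _
  no-maximal-start m (_ ∷ []) (s≤s (s≤s ()) , _) _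
  no-maximal-start m (q₁ ∷ q₂ ∷ qs) (_ , (_ ∷ (q₁∉ ∷ _)) , (mq₁ , _) , closing) bound =
    All.lookup q₁∉ (lastOr-∈ q₁ q₂ qs) (trans (sym to-q₁) to-last)
    where
    to-q₁ : parent m ≡ q₁
    to-q₁ = up-to-parent m q₁ (bound q₁ (here refl)) mq₁
    to-last : parent m ≡ lastOr q₂ qs
    to-last = up-to-parent m (lastOr q₂ qs) (bound _ (there (lastOr-∈ q₁ q₂ qs))) (adj-sym closing)

  acyclic : ¬ HasCycle G
  acyclic cycle with hasCycle⇒Cycle cycle
  ... | [] , ()
  ... | x ∷ xs , c with rank-max x xs
  ... | m , m∈ , bound with ∈-∃++ m∈
  ... | p , q , eq = no-maximal-start m (q ++ p) (rotate p m q (subst Cycle eq c)) rotated-bound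
    where
    rotated-bound : ∀ z → z ∈ q ++ p → rank z ≤ rank m
    rotated-bound z z∈ with ∈-++⁻ q z∈
    ... | inj₁ z∈q = bound z (subst (z ∈_) (sym eq) (∈-++⁺ʳ p (there z∈q)))
    ... | inj₂ z∈p = bound z (subst (z ∈_) (sym eq) (∈-++⁺ˡ z∈p))

module ParentTree {n : ℕ} (root : Fin n) (parent : Fin n → Fin n) (rank : Fin n → ℕ)
                  (descends : ∀ u → u ≢ root → rank (parent u) < rank u) where

  childOf : Fin n → Fin n → Bool
  childOf u v = not (does (u Fin.≟ root)) ∧ does (parent u Fin.≟ v)

  no-self-parent : ∀ u → childOf u u ≡ false
  no-self-parent u with u Fin.≟ root
  ... | yes _      = refl
  ... | no  u≢root = dec-false (parent u Fin.≟ u) loop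
    where loop : parent u ≢ u
          loop eq = <-irrefl (cong rank eq) (descends u u≢root)

  tree : Graph n
  tree = record { adj    = λ u v → childOf u v ∨ childOf v u
                ; sym    = λ u v → ∨-comm (childOf u v) (childOf v u)
                ; irrefl = λ v → cong (λ b → b ∨ b) (no-self-parent v) }

  childOf-sound : ∀ {u v} → T (childOf u v) → u ≢ root × parent u ≡ v
  childOf-sound {u} {v} = sound (u Fin.≟ root) (parent u Fin.≟ v)
    where
    sound : ∀ {A B : Set} (a? : Dec A) (b? : Dec B) → T (not (does a?) ∧ does b?) → ¬ A × B
    sound (no ¬a) (yes b) _ = ¬a , b

  adj-cases : ∀ {u v} → Adj tree u v → (u ≢ root × parent u ≡ v) ⊎ (v ≢ root × parent v ≡ u)
  adj-cases {u} {v} uv with Equivalence.to T-∨ uv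
  ... | inj₁ u→v = inj₁ (childOf-sound u→v)
  ... | inj₂ v→u = inj₂ (childOf-sound v→u)

  adj-parent : ∀ {u} → u ≢ root → Adj tree u (parent u)
  adj-parent {u} u≢root = Equivalence.from T-∨ (inj₁ (complete (u Fin.≟ root) (parent u Fin.≟ parent u) refl))
    where
    complete : ∀ {B : Set} (a? : Dec (u ≡ root)) (b? : Dec B) → B → T (not (does a?) ∧ does b?)
    complete (yes u≡root) _ _ = u≢root u≡root
    complete (no _) (yes _) _ = tt
    complete (no _) (no ¬b) b = ¬b b

  open Paths tree

  -- Following parents reaches the root; the rank bound k serves as fuel.
  path-to-root : ∀ k u → rank u < k → Path u root
  path-to-root (suc k) u (s≤s u<k) with u Fin.≟ root
  ... | yes refl   = stop
  ... | no u≢root  = step (adj-parent u≢root) (path-to-root k (parent u) (≤-trans (descends u u≢root) u<k))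

  connected : Connected tree
  connected u v = path⇒walk (path-to-root _ u ≤-refl ▸ reverse (path-to-root _ v ≤-refl))

  isTree : IsTree tree
  isTree = connected , RankedAcyclic.acyclic tree parent rank oriented
    where
    oriented : ∀ u v → Adj tree u v →
               (parent u ≡ v × rank v < rank u) ⊎ (parent v ≡ u × rank u < rank v)
    oriented u v uv with adj-cases {u} {v} uv
    ... | inj₁ (u≢root , refl) = inj₁ (refl , descends u u≢root)
    ... | inj₂ (v≢root , refl) = inj₂ (refl , descends v v≢root)

-- The extremal trees T(t, s): a root r = R₀ with two leaves R₁, R₂; t claws
-- K₁,₃ with centre Yⱼ₁ and leaves Yⱼ₀, Yⱼ₂, Yⱼ₃, attached to r at Yⱼ₀; and s
-- edges Zᵢ₀ Zᵢ₁, attached to r at Zᵢ₀.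
module Extremal (t s : ℕ) where

  data Vertex : Set where
    R : Fin 3 → Vertex
    Y : Fin t → Fin 4 → Vertex
    Z : Fin s → Fin 2 → Vertex

  root : Vertex
  root = R fz

  parent : Vertex → Vertex
  parent (R _)              = root
  parent (Y j fz)           = root
  parent (Y j (fs fz))      = Y j fz
  parent (Y j (fs (fs _)))  = Y j (fs fz)
  parent (Z i fz)           = root
  parent (Z i (fs _))       = Z i fz

  depth : Vertex → ℕ
  depth (R fz)             = 0
  depth (R (fs _))         = 1
  depth (Y _ fz)           = 1
  depth (Y _ (fs fz))      = 2
  depth (Y _ (fs (fs _)))  = 3
  depth (Z _ fz)           = 1
  depth (Z _ (fs _))       = 2

  descends : ∀ x → x ≢ root → depth (parent x) < depth x
  descends (R fz)            x≢root = ⊥-elim (x≢root refl)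
  descends (R (fs _))        _ = s≤s z≤n
  descends (Y _ fz)          _ = s≤s z≤n
  descends (Y _ (fs fz))     _ = s≤s (s≤s z≤n)
  descends (Y _ (fs (fs _))) _ = s≤s (s≤s (s≤s z≤n))
  descends (Z _ fz)          _ = s≤s z≤n
  descends (Z _ (fs _))      _ = s≤s (s≤s z≤n)

  N : ℕ
  N = 3 + (t * 4 + s * 2)

  enc : Vertex → Fin N
  enc (R i)   = i ↑ˡ (t * 4 + s * 2)
  enc (Y j k) = 3 ↑ʳ (combine j k ↑ˡ (s * 2))
  enc (Z i k) = 3 ↑ʳ ((t * 4) ↑ʳ combine i k)

  decode-legs : Fin (t * 4) ⊎ Fin (s * 2) → Vertex
  decode-legs (inj₁ y) = Y (proj₁ (remQuot {t} 4 y)) (proj₂ (remQuot {t} 4 y))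
  decode-legs (inj₂ z) = Z (proj₁ (remQuot {s} 2 z)) (proj₂ (remQuot {s} 2 z))

  decode : Fin 3 ⊎ Fin (t * 4 + s * 2) → Vertex
  decode (inj₁ i) = R i
  decode (inj₂ u) = decode-legs (splitAt (t * 4) u)

  dec : Fin N → Vertex
  dec u = decode (splitAt 3 u)

  dec-enc : ∀ x → dec (enc x) ≡ x
  dec-enc (R i) = cong decode (Fin.splitAt-↑ˡ 3 i (t * 4 + s * 2))
  dec-enc (Y j k) = begin
    decode (splitAt 3 (3 ↑ʳ (combine j k ↑ˡ (s * 2))))
      ≡⟨ cong decode (Fin.splitAt-↑ʳ 3 (t * 4 + s * 2) _) ⟩
    decode-legs (splitAt (t * 4) (combine j k ↑ˡ (s * 2)))
      ≡⟨ cong decode-legs (Fin.splitAt-↑ˡ (t * 4) (combine j k) (s * 2)) ⟩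
    Y (proj₁ (remQuot {t} 4 (combine j k))) (proj₂ (remQuot {t} 4 (combine j k)))
      ≡⟨ cong (λ p → Y (proj₁ p) (proj₂ p)) (Fin.remQuot-combine {t} {4} j k) ⟩
    Y j k ∎
    where open ≡-Reasoning
  dec-enc (Z i k) = begin
    decode (splitAt 3 (3 ↑ʳ ((t * 4) ↑ʳ combine i k)))
      ≡⟨ cong decode (Fin.splitAt-↑ʳ 3 (t * 4 + s * 2) _) ⟩
    decode-legs (splitAt (t * 4) ((t * 4) ↑ʳ combine i k))
      ≡⟨ cong decode-legs (Fin.splitAt-↑ʳ (t * 4) (s * 2) (combine i k)) ⟩
    Z (proj₁ (remQuot {s} 2 (combine i k))) (proj₂ (remQuot {s} 2 (combine i k)))
      ≡⟨ cong (λ p → Z (proj₁ p) (proj₂ p)) (Fin.remQuot-combine {s} {2} i k) ⟩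
    Z i k ∎
    where open ≡-Reasoning

  rejoin : ∀ {u u' v} → splitAt 3 u ≡ inj₂ u' → splitAt (t * 4) u' ≡ v →
           3 ↑ʳ join (t * 4) (s * 2) v ≡ u
  rejoin {u} {u'} split-u refl =
    trans (cong (3 ↑ʳ_) (Fin.join-splitAt (t * 4) (s * 2) u'))
          (trans (cong (join 3 _) (sym split-u)) (Fin.join-splitAt 3 _ u))

  enc-dec : ∀ u → enc (dec u) ≡ u
  enc-dec u with splitAt 3 u in split-u
  ... | inj₁ i = trans (cong (join 3 _) (sym split-u)) (Fin.join-splitAt 3 _ u)
  ... | inj₂ u' with splitAt (t * 4) u' in split-u'
  ... | inj₁ y = trans (cong (λ w → 3 ↑ʳ (w ↑ˡ (s * 2))) (Fin.combine-remQuot {t} 4 y))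
                       (rejoin split-u split-u')
  ... | inj₂ z = trans (cong (λ w → 3 ↑ʳ ((t * 4) ↑ʳ w)) (Fin.combine-remQuot {s} 2 z))
                       (rejoin split-u split-u')

  ∑-vertices : ∀ (h : Vertex → ℕ) → ∑ N (λ u → h (dec u)) ≡
               ∑ 3 (λ i → h (R i)) + (∑ t (λ j → ∑ 4 (λ k → h (Y j k))) + ∑ s (λ i → ∑ 2 (λ k → h (Z i k))))
  ∑-vertices h =
    trans (∑-split 3 (t * 4 + s * 2) g)
      (cong₂ _+_ (∑-cong 3 (λ i → cong h (dec-enc (R i))))
        (trans (∑-split (t * 4) (s * 2) (λ i → g (3 ↑ʳ i)))
          (cong₂ _+_ (trans (∑-combine t 4 _) (∑-cong t (λ j → ∑-cong 4 (λ k → cong h (dec-enc (Y j k))))))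
                     (trans (∑-combine s 2 _) (∑-cong s (λ i → ∑-cong 2 (λ k → cong h (dec-enc (Z i k)))))))))
    where g = λ u → h (dec u)

  ∑-by-blocks : ∀ (g : Fin N → ℕ) {r y z} →
                r ≤ ∑ 3 (λ i → g (enc (R i))) →
                (∀ j → y ≤ ∑ 4 (λ k → g (enc (Y j k)))) →
                (∀ i → z ≤ ∑ 2 (λ k → g (enc (Z i k)))) →
                r + (t * y + s * z) ≤ ∑ N g
  ∑-by-blocks g {r} {y} {z} r-block y-blocks z-blocks =
    subst (r + (t * y + s * z) ≤_) (sym (trans (∑-cong N (λ u → cong g (sym (enc-dec u))))
                                               (∑-vertices (λ x → g (enc x)))))
      (+-mono-≤ r-block (+-mono-≤ (∑-≥ t y _ y-blocks) (∑-≥ s z _ z-blocks)))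

  dec≢root : ∀ {u} → u ≢ enc root → dec u ≢ root
  dec≢root {u} u≢root dec-u≡root = u≢root (trans (sym (enc-dec u)) (cong enc dec-u≡root))

  module Shape = ParentTree (enc root) (λ u → enc (parent (dec u))) (λ u → depth (dec u))
                  (λ u u≢root → subst (λ x → depth x < depth (dec u)) (sym (dec-enc _))
                                      (descends (dec u) (dec≢root u≢root)))
  open Shape using (tree) public
  open Shape using (isTree; adj-cases; adj-parent)

  Edge : Vertex → Vertex → Set
  Edge x y = (x ≢ root × parent x ≡ y) ⊎ (y ≢ root × parent y ≡ x)

  adj⇒edge : ∀ {u v} → Adj tree u v → Edge (dec u) (dec v)
  adj⇒edge {u} {v} uv with adj-cases {u} {v} uv
  ... | inj₁ (u≢root , up) = inj₁ (dec≢root u≢root , trans (sym (dec-enc _)) (cong dec up))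
  ... | inj₂ (v≢root , vp) = inj₂ (dec≢root v≢root , trans (sym (dec-enc _)) (cong dec vp))

  to-parent : ∀ {x} → x ≢ root → Adj tree (enc x) (enc (parent x))
  to-parent {x} x≢root =
    subst (λ y → Adj tree (enc x) (enc (parent y))) (dec-enc x)
      (adj-parent {enc x} (λ eq → x≢root (trans (sym (dec-enc x)) (trans (cong dec eq) (dec-enc root)))))

  edge⇒adj : ∀ {x y} → Edge x y → Adj tree (enc x) (enc y)
  edge⇒adj (inj₁ (x≢root , refl)) = to-parent x≢root
  edge⇒adj {x} {y} (inj₂ (y≢root , refl)) = GraphFacts.adj-sym tree {enc y} (to-parent y≢root)

  open Bounds tree

  Childless : Vertex → Set
  Childless x = ∀ y → parent y ≢ x

  leaf : ∀ {x} → x ≢ root → Childless x → LeafAt (enc x) (enc (parent x))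
  leaf {x} x≢root childless w xw with adj⇒edge {enc x} {w} xw
  ... | inj₁ (_ , up) = trans (sym (enc-dec w)) (cong enc (trans (sym up) (cong parent (dec-enc x))))
  ... | inj₂ (_ , wp) = ⊥-elim (childless (dec w) (trans wp (dec-enc x)))

  R-leaf : ∀ i → Childless (R (fs i))
  R-leaf i (R _) ()
  R-leaf i (Y _ fz) ()
  R-leaf i (Y _ (fs fz)) ()
  R-leaf i (Y _ (fs (fs _))) ()
  R-leaf i (Z _ fz) ()
  R-leaf i (Z _ (fs _)) ()

  Y-leaf : ∀ j k → Childless (Y j (fs (fs k)))
  Y-leaf j k (R _) ()
  Y-leaf j k (Y _ fz) ()
  Y-leaf j k (Y _ (fs fz)) ()
  Y-leaf j k (Y _ (fs (fs _))) ()
  Y-leaf j k (Z _ fz) ()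
  Y-leaf j k (Z _ (fs _)) ()

  Z-leaf : ∀ i k → Childless (Z i (fs k))
  Z-leaf i k (R _) ()
  Z-leaf i k (Y _ fz) ()
  Z-leaf i k (Y _ (fs fz)) ()
  Z-leaf i k (Y _ (fs (fs _))) ()
  Z-leaf i k (Z _ fz) ()
  Z-leaf i k (Z _ (fs _)) ()

  R≢root : ∀ {i} → R (fs i) ≢ root
  R≢root ()
  Y≢root : ∀ {j k} → Y j k ≢ root
  Y≢root ()
  Z≢root : ∀ {i k} → Z i k ≢ root
  Z≢root ()

  IDS-lower : ∀ S → IsIDS tree S → 1 + (t * 1 + s * 1) ≤ card tree S
  IDS-lower S ids = ∑-by-blocks (λ u → ind (S u)) r-block y-block z-block
    where
    g : Vertex → ℕ
    g x = ind (S (enc x))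
    r-block : 1 ≤ g (R fz) + (g (R (fs fz)) + (g (R (fs (fs fz))) + 0))
    r-block = ≤-trans (leaf-IDS (leaf R≢root (R-leaf fz)) ids) (+-monoʳ-≤ (g (R fz)) (m≤m+n _ _))
    y-block : ∀ j → 1 ≤ g (Y j fz) + (g (Y j (fs fz)) + (g (Y j (fs (fs fz))) + (g (Y j (fs (fs (fs fz)))) + 0)))
    y-block j = ≤-trans (leaf-IDS (leaf Y≢root (Y-leaf j fz)) ids)
                  (≤-trans (+-monoʳ-≤ (g (Y j (fs fz))) (m≤m+n _ _)) (m≤n+m _ (g (Y j fz))))
    z-block : ∀ i → 1 ≤ g (Z i fz) + (g (Z i (fs fz)) + 0)
    z-block i = ≤-trans (leaf-IDS (leaf Z≢root (Z-leaf i fz)) ids) (+-monoʳ-≤ (g (Z i fz)) (m≤m+n _ 0))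

  IDRDF-lower : ∀ f → IsIDRDF tree f → 3 + (t * 3 + s * 2) ≤ weight tree f
  IDRDF-lower f idr = ∑-by-blocks f r-block y-block z-block
    where
    g : Vertex → ℕ
    g x = f (enc x)
    r-block : 3 ≤ g (R fz) + (g (R (fs fz)) + (g (R (fs (fs fz))) + 0))
    r-block = ≤-trans (cherry-IDRDF (leaf R≢root (R-leaf fz)) (leaf R≢root (R-leaf (fs fz)))
                                    (to-parent {R (fs fz)} R≢root) idr)
                      (+-monoʳ-≤ (g (R fz)) (+-monoʳ-≤ (g (R (fs fz))) (m≤m+n _ 0)))
    y-block : ∀ j → 3 ≤ g (Y j fz) + (g (Y j (fs fz)) + (g (Y j (fs (fs fz))) + (g (Y j (fs (fs (fs fz)))) + 0)))
    y-block j = ≤-trans (cherry-IDRDF (leaf Y≢root (Y-leaf j fz)) (leaf Y≢root (Y-leaf j (fs fz)))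
                                      (to-parent {Y j (fs (fs fz))} Y≢root) idr)
                  (≤-trans (+-monoʳ-≤ (g (Y j (fs fz))) (+-monoʳ-≤ (g (Y j (fs (fs fz)))) (m≤m+n _ 0)))
                           (m≤n+m _ (g (Y j fz))))
    z-block : ∀ i → 2 ≤ g (Z i fz) + (g (Z i (fs fz)) + 0)
    z-block i = ≤-trans (leaf-IDRDF (leaf Z≢root (Z-leaf i fz)) idr) (+-monoʳ-≤ (g (Z i fz)) (m≤m+n _ 0))

  chosen : Vertex → Bool
  chosen (R fz)            = true
  chosen (R (fs _))        = false
  chosen (Y _ fz)          = false
  chosen (Y _ (fs fz))     = true
  chosen (Y _ (fs (fs _))) = false
  chosen (Z _ fz)          = false
  chosen (Z _ (fs _))      = true

  chosen-parent : ∀ x → x ≢ root → T (chosen x) → ¬ T (chosen (parent x))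
  chosen-parent (R fz)        x≢root _ = ⊥-elim (x≢root refl)
  chosen-parent (Y _ (fs fz)) _      _ ()
  chosen-parent (Z _ (fs _))  _      _ ()

  chosen-independent : ∀ {x y} → Edge x y → T (chosen x) → ¬ T (chosen y)
  chosen-independent {x} (inj₁ (x≢root , refl)) cx cy = chosen-parent x x≢root cx cy
  chosen-independent {x} {y} (inj₂ (y≢root , refl)) cx cy = chosen-parent y y≢root cy cx

  chosen-dominating : ∀ x → T (chosen x) ⊎ Σ Vertex λ y → T (chosen y) × Edge x y
  chosen-dominating (R fz)            = inj₁ tt
  chosen-dominating (R (fs _))        = inj₂ (root , tt , inj₁ (R≢root , refl))
  chosen-dominating (Y _ fz)          = inj₂ (root , tt , inj₁ (Y≢root , refl))
  chosen-dominating (Y _ (fs fz))     = inj₁ tt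
  chosen-dominating (Y j (fs (fs _))) = inj₂ (Y j (fs fz) , tt , inj₁ (Y≢root , refl))
  chosen-dominating (Z i fz)          = inj₂ (Z i (fs fz) , tt , inj₂ (Z≢root , refl))
  chosen-dominating (Z _ (fs _))      = inj₁ tt

  S₀ : VSet tree
  S₀ u = chosen (dec u)

  S₀-IDS : IsIDS tree S₀
  S₀-IDS = (λ u v su sv uv → chosen-independent (adj⇒edge {u} {v} uv) su sv) , dominating
    where
    dominating : Dominating tree S₀
    dominating u with chosen-dominating (dec u)
    ... | inj₁ su = inj₁ su
    ... | inj₂ (y , sy , e) = inj₂ (enc y , subst (λ x → T (chosen x)) (sym (dec-enc y)) sy ,
                                    subst (λ w → Adj tree w (enc y)) (enc-dec u) (edge⇒adj e))

  S₀-card : card tree S₀ ≡ 1 + (t * 1 + s * 1)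
  S₀-card = trans (∑-vertices (λ x → ind (chosen x)))
                  (cong (1 +_) (cong₂ _+_ (∑-const t 1) (∑-const s 1)))

  value : Vertex → ℕ
  value (R fz)            = 3
  value (R (fs _))        = 0
  value (Y _ fz)          = 0
  value (Y _ (fs fz))     = 3
  value (Y _ (fs (fs _))) = 0
  value (Z _ fz)          = 0
  value (Z _ (fs _))      = 2

  value-≤3 : ∀ x → value x ≤ 3
  value-≤3 (R fz)            = ≤-refl
  value-≤3 (R (fs _))        = z≤n
  value-≤3 (Y _ fz)          = z≤n
  value-≤3 (Y _ (fs fz))     = ≤-refl
  value-≤3 (Y _ (fs (fs _))) = z≤n
  value-≤3 (Z _ fz)          = z≤n
  value-≤3 (Z _ (fs _))      = s≤s (s≤s z≤n)

  value-zero : ∀ x → value x ≡ 0 → x ≢ root × value (parent x) ≡ 3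
  value-zero (R (fs _))        _ = R≢root , refl
  value-zero (Y _ fz)          _ = Y≢root , refl
  value-zero (Y _ (fs (fs _))) _ = Y≢root , refl
  value-zero (Z _ fz)          _ = Z≢root , refl

  value-one : ∀ x → value x ≢ 1
  value-one (R fz)            ()
  value-one (R (fs _))        ()
  value-one (Y _ fz)          ()
  value-one (Y _ (fs fz))     ()
  value-one (Y _ (fs (fs _))) ()
  value-one (Z _ fz)          ()
  value-one (Z _ (fs _))      ()

  value-parent : ∀ x → x ≢ root → value x ≡ 0 ⊎ value (parent x) ≡ 0
  value-parent (R fz)            x≢root = ⊥-elim (x≢root refl)
  value-parent (R (fs _))        _ = inj₁ refl
  value-parent (Y _ fz)          _ = inj₁ refl
  value-parent (Y _ (fs fz))     _ = inj₂ refl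
  value-parent (Y _ (fs (fs _))) _ = inj₁ refl
  value-parent (Z _ fz)          _ = inj₁ refl
  value-parent (Z _ (fs _))      _ = inj₂ refl

  value-edge : ∀ {x y} → Edge x y → value x ≡ 0 ⊎ value y ≡ 0
  value-edge {x} (inj₁ (x≢root , refl)) = value-parent x x≢root
  value-edge {x} {y} (inj₂ (y≢root , refl)) with value-parent y y≢root
  ... | inj₁ vy≡0 = inj₂ vy≡0
  ... | inj₂ vx≡0 = inj₁ vx≡0

  f₀ : Fin N → ℕ
  f₀ u = value (dec u)

  f₀-IDRDF : IsIDRDF tree f₀
  f₀-IDRDF = (λ u → value-≤3 (dec u)) , zero-rule , (λ u v≡1 → ⊥-elim (value-one (dec u) v≡1)) ,
             (λ u v uv → value-edge (adj⇒edge {u} {v} uv))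
    where
    zero-rule : ∀ u → f₀ u ≡ 0 → ZeroGuarded f₀ u
    zero-rule u f₀u≡0 with value-zero (dec u) f₀u≡0
    ... | x≢root , parent-3 =
      inj₁ (enc (parent (dec u)) , subst (λ w → Adj tree w (enc (parent (dec u)))) (enc-dec u) (to-parent x≢root) ,
            trans (cong value (dec-enc _)) parent-3)

  f₀-weight : weight tree f₀ ≡ 3 + (t * 3 + s * 2)
  f₀-weight = trans (∑-vertices value) (cong (3 +_) (cong₂ _+_ (∑-const t 3) (∑-const s 2)))

  realises : 2 ≤ N × IsTree tree × IndepDomNumber tree (1 + (t * 1 + s * 1)) ×
             IndepDoubleRomanNumber tree (3 + (t * 3 + s * 2))
  realises = s≤s (s≤s z≤n) , isTree , ((S₀ , S₀-IDS , S₀-card) , IDS-lower) ,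
             ((f₀ , f₀-IDRDF , f₀-weight) , IDRDF-lower)

slack : ∀ a t → 2 * a + 1 + t ≤ 3 * a → suc t ≤ a
slack a t hi = +-cancelˡ-≤ (2 * a) (suc t) a
                 (subst₂ _≤_ (+-assoc (2 * a) 1 t) (three-times a) hi)
  where
  three-times : ∀ a → 3 * a ≡ 2 * a + a
  three-times = solve-∀

parameters : ∀ a b → 2 * a + 1 ≤ b → b ≤ 3 * a →
             Σ ℕ λ t → Σ ℕ λ s → a ≡ 1 + (t * 1 + s * 1) × b ≡ 3 + (t * 3 + s * 2)
parameters a b lo hi with m≤n⇒∃[o]m+o≡n lo
... | t , refl with m≤n⇒∃[o]m+o≡n (slack a t hi)
... | s , refl = t , s , a-form t s , b-form t s
  where
  a-form : ∀ t s → suc t + s ≡ 1 + (t * 1 + s * 1)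
  a-form = solve-∀
  b-form : ∀ t s → 2 * (suc t + s) + 1 + t ≡ 3 + (t * 3 + s * 2)
  b-form = solve-∀

tree-idR≥2i+1 : ∀ {n} (T : Graph n) → 2 ≤ n → IsTree T → ∀ {a b} →
                IndepDomNumber T a → IndepDoubleRomanNumber T b → 2 * a + 1 ≤ b
tree-idR≥2i+1 T 2≤n (connected , acyclic) (_ , i-min) ((f , idr , refl) , _) =
  idR≥2i+1 T acyclic (connected-edge T 2≤n connected) i-min f idr

theorem20 : (a b : ℕ) → 1 ≤ a → 1 ≤ b →
    (Σ ℕ λ n → Σ (Graph n) λ T → 2 ≤ n × IsTree T ×
       IndepDomNumber T a × IndepDoubleRomanNumber T b)
    ⇔ (2 * a + 1 ≤ b × b ≤ 3 * a)
theorem20 a b _ _ = mk⇔ necessary sufficient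
  where
  necessary : (Σ ℕ λ n → Σ (Graph n) λ T → 2 ≤ n × IsTree T ×
                 IndepDomNumber T a × IndepDoubleRomanNumber T b) →
              2 * a + 1 ≤ b × b ≤ 3 * a
  necessary (n , T , 2≤n , tree , i≡a , idR≡b) =
    tree-idR≥2i+1 T 2≤n tree i≡a idR≡b , Bounds.idR≤3i T i≡a idR≡b

  sufficient : 2 * a + 1 ≤ b × b ≤ 3 * a →
               Σ ℕ λ n → Σ (Graph n) λ T → 2 ≤ n × IsTree T ×
                 IndepDomNumber T a × IndepDoubleRomanNumber T b
  sufficient (lo , hi) with parameters a b lo hi
  ... | t , s , a≡ , b≡ =
    Extremal.N t s , Extremal.tree t s ,
    subst₂ (λ a b → 2 ≤ Extremal.N t s × IsTree (Extremal.tree t s) ×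
                     IndepDomNumber (Extremal.tree t s) a × IndepDoubleRomanNumber (Extremal.tree t s) b)
           (sym a≡) (sym b≡) (Extremal.realises t s)
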